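{- Let $T$ be a haft with $\ell$ leaves. Then the depth of $T$ equals $\lceil\log_2\ell\rceil$.
   Context: A half-full tree (haft) is a rooted binary tree in which every non-leaf node $v$ has exactly two children, and the left child of $v$ is the root of a complete binary subtree (all leaves at the same depth, every internal node with two children) containing at least half of $v$'s descendants. -}

module Defs where

open import Data.Nat using (ℕ; zero; suc; _+_; _*_; _≤_; _⊔_)

data BTree : Set where
  leaf : BTree
  node : BTree → BTree → BTree

size : BTree → ℕ
size leaf = 1
size (node l r) = suc (size l + size r)

leaves : BTree → ℕ
leaves leaf = 1
leaves (node l r) = leaves l + leaves r

depth : BTree → ℕ
depth leaf = 0
depth (node l r) = suc (depth l ⊔ depth r)

data CompleteOfDepth : ℕ → BTree → Set where
  leaf : CompleteOfDepth 0 leaf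
  node : ∀ {h l r} → CompleteOfDepth h l → CompleteOfDepth h r →
         CompleteOfDepth (suc h) (node l r)

data Complete (t : BTree) : Set where
  complete : ∀ h → CompleteOfDepth h t → Complete t

descendants : BTree → ℕ
descendants leaf = 0
descendants (node l r) = size l + size r

data Haft : BTree → Set where
  leaf : Haft leaf
  node : ∀ {l r} → Complete l → descendants (node l r) ≤ 2 * size l →
         Haft l → Haft r → Haft (node l r)

module Submission where

open import Data.Nat using (zero; suc; _+_; _*_; _∸_; _^_; _≤_; _<_; _⊔_; ⌊_/2⌋; ⌈_/2⌉; s≤s; z≤n)
open import Data.Nat.Logarithm using (⌈log₂_⌉; ⌈log₂⌉-mono-≤; ⌈log₂2^n⌉≡n; ⌈log₂⌈n/2⌉⌉≡⌈log₂n⌉∸1)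
open import Data.Nat.Properties
open import Relation.Binary.PropositionalEquality using (_≡_; refl; sym; cong; cong₂; subst; subst₂; module ≡-Reasoning)

open import Defs

-- A complete left subtree with 2^h leaves and a right subtree with at most 2^h leaves give
-- 2^h < ℓ ≤ 2^(h+1), pinning ⌈log₂ ℓ⌉ to h + 1; by induction the right subtree has depth at
-- most ⌈log₂ 2^h⌉ = h, so the depth is also h + 1.

m+m<n⇒m<⌈n/2⌉ : ∀ m {n} → m + m < n → m < ⌈ n /2⌉
m+m<n⇒m<⌈n/2⌉ m {n} m+m<n = begin-strict
  m                    <⟨ n<1+n m ⟩
  suc m                ≡⟨ n≡⌊n+n/2⌋ (suc m) ⟩
  ⌊ suc m + suc m /2⌋  ≤⟨ ⌊n/2⌋-mono (subst (_≤ suc n) (cong suc (sym (+-suc m m))) (s≤s m+m<n)) ⟩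
  ⌊ suc n /2⌋          ∎
  where open ≤-Reasoning

n≤2^h⇒⌈log₂n⌉≤h : ∀ h {n} → n ≤ 2 ^ h → ⌈log₂ n ⌉ ≤ h
n≤2^h⇒⌈log₂n⌉≤h h n≤2^h = subst (_ ≤_) (⌈log₂2^n⌉≡n h) (⌈log₂⌉-mono-≤ n≤2^h)

2^h<n⇒h<⌈log₂n⌉ : ∀ h {n} → 2 ^ h < n → h < ⌈log₂ n ⌉
2^h<n⇒h<⌈log₂n⌉ zero    1<n     = ⌈log₂⌉-mono-≤ 1<n
2^h<n⇒h<⌈log₂n⌉ (suc h) {n} 2^[1+h]<n =
  1+m≤n∸1⇒2+m≤n (subst (h <_) (⌈log₂⌈n/2⌉⌉≡⌈log₂n⌉∸1 n) (2^h<n⇒h<⌈log₂n⌉ h 2^h<⌈n/2⌉))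
  where
  2^h<⌈n/2⌉ : 2 ^ h < ⌈ n /2⌉
  2^h<⌈n/2⌉ = m+m<n⇒m<⌈n/2⌉ (2 ^ h) (subst (_< n) (cong (2 ^ h +_) (+-identityʳ (2 ^ h))) 2^[1+h]<n)
  1+m≤n∸1⇒2+m≤n : ∀ {m k} → suc m ≤ k ∸ 1 → suc (suc m) ≤ k
  1+m≤n∸1⇒2+m≤n {k = suc k} le = s≤s le

⌈log₂[2^h+n]⌉≡1+h : ∀ h {n} → 0 < n → n ≤ 2 ^ h → ⌈log₂ (2 ^ h + n) ⌉ ≡ suc h
⌈log₂[2^h+n]⌉≡1+h h {n} 0<n n≤2^h = ≤-antisym
  (n≤2^h⇒⌈log₂n⌉≤h (suc h) (+-monoʳ-≤ (2 ^ h) (subst (n ≤_) (sym (+-identityʳ (2 ^ h))) n≤2^h)))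
  (2^h<n⇒h<⌈log₂n⌉ h (m<m+n (2 ^ h) 0<n))

m+n≤2*m⇒n≤m : ∀ m n → m + n ≤ 2 * m → n ≤ m
m+n≤2*m⇒n≤m m n le = +-cancelˡ-≤ m n m (subst (m + n ≤_) (cong (m +_) (+-identityʳ m)) le)

0<leaves : ∀ t → 0 < leaves t
0<leaves leaf       = s≤s z≤n
0<leaves (node l r) = ≤-trans (0<leaves l) (m≤m+n (leaves l) (leaves r))

suc-size≡2*leaves : ∀ t → suc (size t) ≡ 2 * leaves t
suc-size≡2*leaves leaf       = refl
suc-size≡2*leaves (node l r) = begin
  suc (suc (size l + size r))   ≡⟨ cong suc (sym (+-suc (size l) (size r))) ⟩
  suc (size l) + suc (size r)   ≡⟨ cong₂ _+_ (suc-size≡2*leaves l) (suc-size≡2*leaves r) ⟩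
  2 * leaves l + 2 * leaves r   ≡⟨ sym (*-distribˡ-+ 2 (leaves l) (leaves r)) ⟩
  2 * (leaves l + leaves r)     ∎
  where open ≡-Reasoning

size≤⇒leaves≤ : ∀ s t → size s ≤ size t → leaves s ≤ leaves t
size≤⇒leaves≤ s t size≤ =
  *-cancelˡ-≤ 2 (subst₂ _≤_ (suc-size≡2*leaves s) (suc-size≡2*leaves t) (s≤s size≤))

complete⇒leaves≡2^h : ∀ {h t} → CompleteOfDepth h t → leaves t ≡ 2 ^ h
complete⇒leaves≡2^h leaf             = refl
complete⇒leaves≡2^h (node {h} cl cr) = begin
  _                    ≡⟨ cong₂ _+_ (complete⇒leaves≡2^h cl) (complete⇒leaves≡2^h cr) ⟩
  2 ^ h + 2 ^ h        ≡⟨ cong (2 ^ h +_) (sym (+-identityʳ (2 ^ h))) ⟩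
  2 ^ suc h            ∎
  where open ≡-Reasoning

complete⇒depth≡h : ∀ {h t} → CompleteOfDepth h t → depth t ≡ h
complete⇒depth≡h leaf         = refl
complete⇒depth≡h (node cl cr) rewrite complete⇒depth≡h cl | complete⇒depth≡h cr = cong suc (⊔-idem _)

corollary4p1 : (T : BTree) → Haft T → depth T ≡ ⌈log₂ leaves T ⌉
corollary4p1 leaf leaf = refl
corollary4p1 (node l r) (node (complete h l-complete) balanced _ r-haft) = begin
  suc (depth l ⊔ depth r)        ≡⟨ cong (λ d → suc (d ⊔ depth r)) (complete⇒depth≡h l-complete) ⟩
  suc (h ⊔ depth r)              ≡⟨ cong suc (m≥n⇒m⊔n≡m depth-r≤h) ⟩
  suc h                          ≡⟨ sym (⌈log₂[2^h+n]⌉≡1+h h (0<leaves r) leaves-r≤2^h) ⟩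
  ⌈log₂ (2 ^ h + leaves r) ⌉     ≡⟨ cong (λ k → ⌈log₂ (k + leaves r) ⌉) (sym leaves-l≡2^h) ⟩
  ⌈log₂ (leaves l + leaves r) ⌉  ∎
  where
  open ≡-Reasoning
  leaves-l≡2^h : leaves l ≡ 2 ^ h
  leaves-l≡2^h = complete⇒leaves≡2^h l-complete
  leaves-r≤2^h : leaves r ≤ 2 ^ h
  leaves-r≤2^h = subst (leaves r ≤_) leaves-l≡2^h
    (size≤⇒leaves≤ r l (m+n≤2*m⇒n≤m (size l) (size r) balanced))
  depth-r≤h : depth r ≤ h
  depth-r≤h = subst (_≤ h) (sym (corollary4p1 r r-haft)) (n≤2^h⇒⌈log₂n⌉≤h h leaves-r≤2^h)
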